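{- Let $\mathcal{C}=\{r_1 \bmod q_1, r_2\bmod q_2,\dots,r_k \bmod q_k\}$ be a minimal covering system with $q_1<q_2<\cdots<q_k$. For $\ell\in\{1,\dots,k\}$ define \[ \mathcal{C}_\ell=\big\{ r_j-h \bmod q_j : \ell\le j\le k,\ 0\le h<2^{\ell-1}\big\}. \] Then $\mathcal{C}_\ell$ is a covering system for every $\ell=1,2,\dots,k$.
   Context: A covering system is a finite set of arithmetic progressions (congruence classes $r \bmod q$) whose union is $\mathbb{Z}$. A covering system is minimal if no proper subset of its arithmetic progressions covers $\mathbb{Z}$. -}

module Defs where

open import Data.Nat using (ℕ; _≤_; _<_; _^_; NonZero)
open import Data.Integer using (ℤ; +_; _-_)
open import Data.Integer.Divisibility using (_∣_)
open import Data.Fin using (Fin; toℕ)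
open import Data.Fin.Subset using (Subset; _∈_)
open import Data.Product using (Σ; ∃; _×_; _,_)
open import Relation.Binary.PropositionalEquality using (_≡_)

record AP : Set where
  constructor _mod_
  field
    residue : ℤ
    modulus : ℕ
open AP public

_∈AP_ : ℤ → AP → Set
n ∈AP (r mod q) = (+ q) ∣ (n - r)

CoversℤSet : (AP → Set) → Set
CoversℤSet P = ∀ (n : ℤ) → Σ AP λ a → P a × n ∈AP a

Sub : ∀ {k} → (Fin k → ℤ) → (Fin k → ℕ) → Subset k → AP → Set
Sub {k} r q S a = Σ (Fin k) λ i → i ∈ S × a ≡ (r i mod q i)

Fam : ∀ {k} → (Fin k → ℤ) → (Fin k → ℕ) → AP → Set
Fam {k} r q a = Σ (Fin k) λ i → a ≡ (r i mod q i)

IsCovering : ∀ {k} → (Fin k → ℤ) → (Fin k → ℕ) → Set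
IsCovering r q = CoversℤSet (Fam r q)

IsMinimalCovering : ∀ {k} → (Fin k → ℤ) → (Fin k → ℕ) → Set
IsMinimalCovering {k} r q =
  IsCovering r q × (∀ (S : Subset k) → CoversℤSet (Sub r q S) → ∀ i → i ∈ S)

-- C_ℓ for ℓ ∈ {1..k}, indexed by ℓ' : Fin k with ℓ = toℕ ℓ' + 1, so 2^(ℓ-1) = 2^(toℕ ℓ'):
-- { r_j - h mod q_j : ℓ ≤ j ≤ k, 0 ≤ h < 2^(ℓ-1) }.
Cℓ : ∀ {k} → (Fin k → ℤ) → (Fin k → ℕ) → Fin k → AP → Set
Cℓ {k} r q ℓ a = Σ (Fin k) λ j → Σ ℕ λ h →
  toℕ ℓ ≤ toℕ j × h < 2 ^ toℕ ℓ × a ≡ ((r j - + h) mod q j)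

-- A family of m congruence classes covering 2^m consecutive integers covers ℤ
-- (Crittenden–Vanden Eynden). Granting this, suppose n is not covered by C_ℓ.
-- Every n + t with t < 2^(ℓ-1) lies in some class r_j mod q_j, and j < ℓ, for
-- otherwise n ∈ r_j − t mod q_j ∈ C_ℓ. So the ℓ − 1 classes before the ℓ-th cover
-- ℤ, contradicting minimality.
--
-- For the interval lemma, write f(x, γ) = ∏ᵢ ([qᵢ ∣ γᵢ] − [qᵢ ∣ γᵢ − (x − rᵢ)]) for
-- γ ∈ ℤ^m. At γ = 0 it is 1 when x is uncovered, and it vanishes identically in γ
-- when x is covered. Expanding the product, f is a sum of N = 2^m terms Cⱼ(γ − x vⱼ).
-- Such a sum vanishing identically for N consecutive x vanishes for all x: its
-- difference f(x + 1, γ + v₁) − f(x, γ) is a sum of N − 1 such terms, so by induction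
-- it is zero, and f(x, ·) = 0 then propagates from one x to all.

module Submission where

open import Data.Bool.Properties using (T-≡)
open import Data.Empty using (⊥-elim)
open import Data.Fin using (Fin; zero; suc; toℕ; fromℕ<; inject)
open import Data.Fin.Properties using (any?; toℕ<n; toℕ-fromℕ<; toℕ-inject; toℕ-injective)
open import Data.Fin.Subset using (Subset; _∈_)
open import Data.Integer using (ℤ; +_; -[1+_]; 0ℤ; 1ℤ; -_; _+_; _-_; _*_; ∣_∣)
open import Data.Integer.Divisibility using () renaming (_∣_ to _∣ᵤ_)
open import Data.Integer.Divisibility.Signed using (_∣_; _∣?_; ∣ᵤ⇒∣; ∣⇒∣ᵤ; ∣m∣n⇒∣m-n; ∣m∣n⇒∣m+n; ∣m⇒∣-m)
import Data.Integer.Properties as ℤ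
open import Data.Integer.Tactic.RingSolver using (solve-∀)
open import Data.Nat using (ℕ; zero; suc; _<_; _≤_; _^_; _<ᵇ_; s≤s; z≤n)
import Data.Nat.Divisibility as ℕ
import Data.Nat.Properties as ℕ
open import Data.Product using (_×_; _,_; ∃-syntax)
open import Data.Vec using (Vec; []; _∷_; _++_; map; zipWith; replicate; tabulate; _⊛*_)
open import Data.Vec.Properties using (lookup∘tabulate; lookup⇒[]=; []=⇒lookup)
open import Function using (_∘_; Equivalence)
open import Relation.Binary.PropositionalEquality using (_≡_; refl; sym; trans; cong; cong₂; subst; module ≡-Reasoning)
open import Relation.Nullary using (Dec; yes; no; ¬_)
open import Relation.Nullary.Decidable using (_×-dec_)

open import Defs

ℤ^_ : ℕ → Set
ℤ^ d = Vec ℤ d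

infixl 6 _⊕_ _⊖_
infixl 7 _·_

_⊕_ _⊖_ : ∀ {d} → ℤ^ d → ℤ^ d → ℤ^ d
_⊕_ = zipWith _+_
_⊖_ = zipWith _-_

_·_ : ∀ {d} → ℤ → ℤ^ d → ℤ^ d
x · v = map (x *_) v

⊖-⊕-cancel : ∀ {d} (γ v : ℤ^ d) → γ ⊖ v ⊕ v ≡ γ
⊖-⊕-cancel []      []      = refl
⊖-⊕-cancel (g ∷ γ) (v ∷ w) = cong₂ _∷_ (scalar g v) (⊖-⊕-cancel γ w)
  where scalar : ∀ g v → g - v + v ≡ g
        scalar = solve-∀

⊕-⊖-cancel : ∀ {d} (γ v : ℤ^ d) → γ ⊕ v ⊖ v ≡ γ
⊕-⊖-cancel []      []      = refl
⊕-⊖-cancel (g ∷ γ) (v ∷ w) = cong₂ _∷_ (scalar g v) (⊕-⊖-cancel γ w)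
  where scalar : ∀ g v → g + v - v ≡ g
        scalar = solve-∀

⊕-⊖-suc· : ∀ {d} (γ v w : ℤ^ d) x → γ ⊕ v ⊖ (x + 1ℤ) · w ≡ γ ⊖ x · w ⊕ v ⊖ w
⊕-⊖-suc· []      []      []      x = refl
⊕-⊖-suc· (g ∷ γ) (v ∷ vs) (w ∷ ws) x = cong₂ _∷_ (scalar g v w x) (⊕-⊖-suc· γ vs ws x)
  where scalar : ∀ g v w x → g + v - (x + 1ℤ) * w ≡ g - x * w + v - w
        scalar = solve-∀

Term : ℕ → Set
Term d = ℤ^ d × (ℤ^ d → ℤ)

evalTerm : ∀ {d} → Term d → ℤ → ℤ^ d → ℤ
evalTerm (v , C) x γ = C (γ ⊖ x · v)

shiftSum : ∀ {d n} → Vec (Term d) n → ℤ → ℤ^ d → ℤ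
shiftSum []      x γ = 0ℤ
shiftSum (t ∷ L) x γ = evalTerm t x γ + shiftSum L x γ

Δ : ∀ {d} → ℤ^ d → Term d → Term d
Δ v (w , C) = w , λ δ → C (δ ⊕ v ⊖ w) - C δ

evalTerm-Δ : ∀ {d} (v : ℤ^ d) t x γ → evalTerm (Δ v t) x γ ≡ evalTerm t (x + 1ℤ) (γ ⊕ v) - evalTerm t x γ
evalTerm-Δ v (w , C) x γ = cong (λ δ → C δ - C (γ ⊖ x · w)) (sym (⊕-⊖-suc· γ v w x))

shiftSum-Δ : ∀ {d n} (v : ℤ^ d) (L : Vec (Term d) n) x γ →
  shiftSum (map (Δ v) L) x γ ≡ shiftSum L (x + 1ℤ) (γ ⊕ v) - shiftSum L x γ
shiftSum-Δ v []      x γ = refl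
shiftSum-Δ v (t ∷ L) x γ =
  trans (cong₂ _+_ (evalTerm-Δ v t x γ) (shiftSum-Δ v L x γ))
        (interchange (evalTerm t (x + 1ℤ) (γ ⊕ v)) (evalTerm t x γ) (shiftSum L (x + 1ℤ) (γ ⊕ v)) (shiftSum L x γ))
  where
  interchange : ∀ a b c e → (a - b) + (c - e) ≡ (a + c) - (b + e)
  interchange = solve-∀

shiftSum-Δ-head : ∀ {d n} (v : ℤ^ d) C (L : Vec (Term d) n) x γ →
  shiftSum ((v , C) ∷ L) (x + 1ℤ) (γ ⊕ v) - shiftSum ((v , C) ∷ L) x γ ≡ shiftSum (map (Δ v) L) x γ
shiftSum-Δ-head v C L x γ = begin
  shiftSum ((v , C) ∷ L) (x + 1ℤ) (γ ⊕ v) - shiftSum ((v , C) ∷ L) x γ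
    ≡⟨ sym (shiftSum-Δ v ((v , C) ∷ L) x γ) ⟩
  C (γ ⊖ x · v ⊕ v ⊖ v) - C (γ ⊖ x · v) + shiftSum (map (Δ v) L) x γ
    ≡⟨ cong (λ δ → C δ - C (γ ⊖ x · v) + shiftSum (map (Δ v) L) x γ) (⊕-⊖-cancel (γ ⊖ x · v) v) ⟩
  C (γ ⊖ x · v) - C (γ ⊖ x · v) + shiftSum (map (Δ v) L) x γ
    ≡⟨ cong (_+ shiftSum (map (Δ v) L) x γ) (ℤ.+-inverseʳ (C (γ ⊖ x · v))) ⟩
  0ℤ + shiftSum (map (Δ v) L) x γ
    ≡⟨ ℤ.+-identityˡ _ ⟩
  shiftSum (map (Δ v) L) x γ ∎
  where open ≡-Reasoning

i+[1+n]≡i+n+1 : ∀ i n → i + + suc n ≡ i + + n + 1ℤ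
i+[1+n]≡i+n+1 i n = trans (cong (λ j → i + j) (ℤ.pos-+ 1 n)) (i+[1+j]≡i+j+1 i (+ n))
  where i+[1+j]≡i+j+1 : ∀ i j → i + (1ℤ + j) ≡ i + j + 1ℤ
        i+[1+j]≡i+j+1 = solve-∀

ℤ-induction-from : ∀ (P : ℤ → Set) a → P a →
  (∀ x → P x → P (x + 1ℤ)) → (∀ x → P (x + 1ℤ) → P x) → ∀ x → P x
ℤ-induction-from P a Pa up down x = subst P (i+[j-i]≡j a x) (aroundA (x - a))
  where
  i+[j-i]≡j : ∀ i j → i + (j - i) ≡ j
  i+[j-i]≡j = solve-∀
  i-[1+j]+1≡i-j : ∀ i j → i - (1ℤ + j) + 1ℤ ≡ i - j
  i-[1+j]+1≡i-j = solve-∀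
  above : ∀ n → P (a + + n)
  above zero    = subst P (sym (ℤ.+-identityʳ a)) Pa
  above (suc n) = subst P (sym (i+[1+n]≡i+n+1 a n)) (up _ (above n))
  below : ∀ n → P (a - + n)
  below zero    = subst P (sym (ℤ.+-identityʳ a)) Pa
  below (suc n) = down _ (subst P a-n≡a-[1+n]+1 (below n))
    where a-n≡a-[1+n]+1 = sym (trans (cong (λ j → a - j + 1ℤ) (ℤ.pos-+ 1 n)) (i-[1+j]+1≡i-j a (+ n)))
  aroundA : ∀ z → P (a + z)
  aroundA (+ n)    = above n
  aroundA -[1+ n ] = below (suc n)

shiftSum-vanishes : ∀ {d n} (L : Vec (Term d) n) a →
  (∀ t → t < n → ∀ γ → shiftSum L (a + + t) γ ≡ 0ℤ) → ∀ x γ → shiftSum L x γ ≡ 0ℤ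
shiftSum-vanishes []                          _ _ _ _ = refl
shiftSum-vanishes {n = suc n} ((v , C) ∷ L) a vanishesOnInterval =
  ℤ-induction-from (λ x → ∀ γ → S x γ ≡ 0ℤ) (a + + 0) (vanishesOnInterval 0 (s≤s z≤n))
    (λ x Sx≡0 γ → trans (cong (S (x + 1ℤ)) (sym (⊖-⊕-cancel γ v)))
                        (trans (invariant x (γ ⊖ v)) (Sx≡0 (γ ⊖ v))))
    (λ x Sx+1≡0 γ → trans (sym (invariant x γ)) (Sx+1≡0 (γ ⊕ v)))
  where
  S = shiftSum ((v , C) ∷ L)
  ΔS-vanishesOnInterval : ∀ t → t < n → ∀ γ → shiftSum (map (Δ v) L) (a + + t) γ ≡ 0ℤ
  ΔS-vanishesOnInterval t t<n γ = begin
    shiftSum (map (Δ v) L) (a + + t) γ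
      ≡⟨ sym (shiftSum-Δ-head v C L (a + + t) γ) ⟩
    S (a + + t + 1ℤ) (γ ⊕ v) - S (a + + t) γ
      ≡⟨ cong (λ y → S y (γ ⊕ v) - S (a + + t) γ) (sym (i+[1+n]≡i+n+1 a t)) ⟩
    S (a + + suc t) (γ ⊕ v) - S (a + + t) γ
      ≡⟨ cong₂ _-_ (vanishesOnInterval (suc t) (s≤s t<n) (γ ⊕ v))
                   (vanishesOnInterval t (ℕ.m<n⇒m<1+n t<n) γ) ⟩
    0ℤ ∎
    where open ≡-Reasoning
  invariant : ∀ x γ → S (x + 1ℤ) (γ ⊕ v) ≡ S x γ
  invariant x γ = ℤ.i-j≡0⇒i≡j _ _ (trans (shiftSum-Δ-head v C L x γ)
    (shiftSum-vanishes (map (Δ v) L) a ΔS-vanishesOnInterval x γ))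

shiftSum-++ : ∀ {d m n} (L₁ : Vec (Term d) m) (L₂ : Vec (Term d) n) x γ →
  shiftSum (L₁ ++ L₂) x γ ≡ shiftSum L₁ x γ + shiftSum L₂ x γ
shiftSum-++ []       L₂ x γ = sym (ℤ.+-identityˡ _)
shiftSum-++ (t ∷ L₁) L₂ x γ = trans (cong (_+_ (evalTerm t x γ)) (shiftSum-++ L₁ L₂ x γ))
  (sym (ℤ.+-assoc (evalTerm t x γ) (shiftSum L₁ x γ) (shiftSum L₂ x γ)))

infixr 7 _⊗_

_⊗_ : ∀ {d} → Term 1 → Term d → Term (suc d)
(e ∷ [] , α) ⊗ (v , C) = e ∷ v , λ { (g ∷ γ) → α (g ∷ []) * C γ }

shiftSum-map-⊗ : ∀ {d n} s (L : Vec (Term d) n) x g γ →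
  shiftSum (map (s ⊗_) L) x (g ∷ γ) ≡ evalTerm s x (g ∷ []) * shiftSum L x γ
shiftSum-map-⊗ s []      x g γ = sym (ℤ.*-zeroʳ (evalTerm s x (g ∷ [])))
shiftSum-map-⊗ s@(e ∷ [] , α) (t ∷ L) x g γ =
  trans (cong (_+_ (evalTerm (s ⊗ t) x (g ∷ γ))) (shiftSum-map-⊗ s L x g γ))
    (sym (ℤ.*-distribˡ-+ (evalTerm s x (g ∷ [])) (evalTerm t x γ) (shiftSum L x γ)))

shiftSum-⊗ : ∀ {d m n} (S : Vec (Term 1) m) (L : Vec (Term d) n) x g γ →
  shiftSum (map _⊗_ S ⊛* L) x (g ∷ γ) ≡ shiftSum S x (g ∷ []) * shiftSum L x γ
shiftSum-⊗ []      L x g γ = refl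
shiftSum-⊗ (s ∷ S) L x g γ = begin
  shiftSum (map (s ⊗_) L ++ (map _⊗_ S ⊛* L)) x (g ∷ γ)
    ≡⟨ shiftSum-++ (map (s ⊗_) L) (map _⊗_ S ⊛* L) x (g ∷ γ) ⟩
  shiftSum (map (s ⊗_) L) x (g ∷ γ) + shiftSum (map _⊗_ S ⊛* L) x (g ∷ γ)
    ≡⟨ cong₂ _+_ (shiftSum-map-⊗ s L x g γ) (shiftSum-⊗ S L x g γ) ⟩
  evalTerm s x (g ∷ []) * shiftSum L x γ + shiftSum S x (g ∷ []) * shiftSum L x γ
    ≡⟨ sym (ℤ.*-distribʳ-+ (shiftSum L x γ) (evalTerm s x (g ∷ [])) (shiftSum S x (g ∷ []))) ⟩
  shiftSum (s ∷ S) x (g ∷ []) * shiftSum L x γ ∎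
  where open ≡-Reasoning

𝟙 : ∀ {P : Set} → Dec P → ℤ
𝟙 (yes _) = 1ℤ
𝟙 (no _)  = 0ℤ

𝟙-cong : ∀ {P Q : Set} → (P → Q) → (Q → P) → (p : Dec P) (q : Dec Q) → 𝟙 p ≡ 𝟙 q
𝟙-cong P⇒Q Q⇒P (yes _) (yes _) = refl
𝟙-cong P⇒Q Q⇒P (yes p) (no ¬q) = ⊥-elim (¬q (P⇒Q p))
𝟙-cong P⇒Q Q⇒P (no ¬p) (yes q) = ⊥-elim (¬p (Q⇒P q))
𝟙-cong P⇒Q Q⇒P (no _)  (no _)  = refl

[_∣_] : ℕ → ℤ → ℤ
[ q ∣ z ] = 𝟙 (+ q ∣? z)

classFactor : ℤ → ℕ → Vec (Term 1) 2
classFactor r q = (0ℤ ∷ [] , λ { (g ∷ []) → [ q ∣ g ] })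
                ∷ (1ℤ ∷ [] , λ { (g ∷ []) → - [ q ∣ g + r ] })
                ∷ []

classFactor-value : ∀ r q x g → shiftSum (classFactor r q) x (g ∷ []) ≡ [ q ∣ g ] - [ q ∣ g - (x - r) ]
classFactor-value r q x g = begin
  [ q ∣ g - x * 0ℤ ] + (- [ q ∣ g - x * 1ℤ + r ] + 0ℤ)
    ≡⟨ cong (_+_ [ q ∣ g - x * 0ℤ ]) (ℤ.+-identityʳ _) ⟩
  [ q ∣ g - x * 0ℤ ] - [ q ∣ g - x * 1ℤ + r ]
    ≡⟨ cong₂ (λ y z → [ q ∣ y ] - [ q ∣ z ]) (g-x*0≡g g x) (g-x*1+r≡g-[x-r] g x r) ⟩
  [ q ∣ g ] - [ q ∣ g - (x - r) ] ∎
  where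
  open ≡-Reasoning
  g-x*0≡g : ∀ g x → g - x * 0ℤ ≡ g
  g-x*0≡g = solve-∀
  g-x*1+r≡g-[x-r] : ∀ g x r → g - x * 1ℤ + r ≡ g - (x - r)
  g-x*1+r≡g-[x-r] = solve-∀

[∣]-shift : ∀ q g {d} → (+ q) ∣ᵤ d → [ q ∣ g - d ] ≡ [ q ∣ g ]
[∣]-shift q g {d} q∣d = 𝟙-cong
  (λ q∣g-d → subst (+ q ∣_) (g-d+d≡g g d) (∣m∣n⇒∣m+n q∣g-d (∣ᵤ⇒∣ q∣d)))
  (λ q∣g → ∣m∣n⇒∣m-n q∣g (∣ᵤ⇒∣ q∣d))
  (+ q ∣? g - d) (+ q ∣? g)
  where
  g-d+d≡g : ∀ g d → g - d + d ≡ g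
  g-d+d≡g = solve-∀

[∣0]≡1 : ∀ q → [ q ∣ 0ℤ ] ≡ 1ℤ
[∣0]≡1 q with + q ∣? 0ℤ
... | yes _   = refl
... | no  q∤0 = ⊥-elim (q∤0 (∣ᵤ⇒∣ (q ℕ.∣0)))

uncoveredIndicator : ∀ {m} → (Fin m → ℤ) → (Fin m → ℕ) → Vec (Term m) (2 ^ m)
uncoveredIndicator {zero}  r q = ([] , λ _ → 1ℤ) ∷ []
uncoveredIndicator {suc m} r q =
  map _⊗_ (classFactor (r zero) (q zero)) ⊛* uncoveredIndicator (r ∘ suc) (q ∘ suc)

uncoveredIndicator-suc : ∀ {m} (r : Fin (suc m) → ℤ) q x g γ →
  shiftSum (uncoveredIndicator r q) x (g ∷ γ)
    ≡ ([ q zero ∣ g ] - [ q zero ∣ g - (x - r zero) ]) * shiftSum (uncoveredIndicator (r ∘ suc) (q ∘ suc)) x γ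
uncoveredIndicator-suc r q x g γ =
  trans (shiftSum-⊗ (classFactor (r zero) (q zero)) (uncoveredIndicator (r ∘ suc) (q ∘ suc)) x g γ)
        (cong (_* shiftSum (uncoveredIndicator (r ∘ suc) (q ∘ suc)) x γ) (classFactor-value (r zero) (q zero) x g))

uncoveredIndicator-covered : ∀ {m} (r : Fin m → ℤ) q x i → x ∈AP (r i mod q i) →
  ∀ γ → shiftSum (uncoveredIndicator r q) x γ ≡ 0ℤ
uncoveredIndicator-covered r q x zero x∈ (g ∷ γ) = begin
  shiftSum (uncoveredIndicator r q) x (g ∷ γ)
    ≡⟨ uncoveredIndicator-suc r q x g γ ⟩
  ([ q zero ∣ g ] - [ q zero ∣ g - (x - r zero) ]) * rest
    ≡⟨ cong (λ z → ([ q zero ∣ g ] - z) * rest) ([∣]-shift (q zero) g x∈) ⟩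
  ([ q zero ∣ g ] - [ q zero ∣ g ]) * rest
    ≡⟨ cong (_* rest) (ℤ.+-inverseʳ [ q zero ∣ g ]) ⟩
  0ℤ * rest
    ≡⟨ ℤ.*-zeroˡ rest ⟩
  0ℤ ∎
  where
  open ≡-Reasoning
  rest = shiftSum (uncoveredIndicator (r ∘ suc) (q ∘ suc)) x γ
uncoveredIndicator-covered r q x (suc i) x∈ (g ∷ γ) = begin
  shiftSum (uncoveredIndicator r q) x (g ∷ γ)
    ≡⟨ uncoveredIndicator-suc r q x g γ ⟩
  factor * shiftSum (uncoveredIndicator (r ∘ suc) (q ∘ suc)) x γ
    ≡⟨ cong (factor *_) (uncoveredIndicator-covered (r ∘ suc) (q ∘ suc) x i x∈ γ) ⟩
  factor * 0ℤ
    ≡⟨ ℤ.*-zeroʳ factor ⟩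
  0ℤ ∎
  where
  open ≡-Reasoning
  factor = [ q zero ∣ g ] - [ q zero ∣ g - (x - r zero) ]

uncoveredIndicator-uncovered : ∀ {m} (r : Fin m → ℤ) q x → (∀ i → ¬ x ∈AP (r i mod q i)) →
  shiftSum (uncoveredIndicator r q) x (replicate m 0ℤ) ≡ 1ℤ
uncoveredIndicator-uncovered {zero}  r q x x∉ = refl
uncoveredIndicator-uncovered {suc m} r q x x∉ = begin
  shiftSum (uncoveredIndicator r q) x (0ℤ ∷ replicate m 0ℤ)
    ≡⟨ uncoveredIndicator-suc r q x 0ℤ (replicate m 0ℤ) ⟩
  ([ q zero ∣ 0ℤ ] - [ q zero ∣ 0ℤ - (x - r zero) ]) * rest
    ≡⟨ cong₂ (λ y z → (y - z) * rest) ([∣0]≡1 (q zero)) [∣-[x-r]]≡0 ⟩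
  1ℤ * rest
    ≡⟨ ℤ.*-identityˡ rest ⟩
  rest
    ≡⟨ uncoveredIndicator-uncovered (r ∘ suc) (q ∘ suc) x (x∉ ∘ suc) ⟩
  1ℤ ∎
  where
  open ≡-Reasoning
  rest = shiftSum (uncoveredIndicator (r ∘ suc) (q ∘ suc)) x (replicate m 0ℤ)
  -[0-y]≡y : ∀ y → - (0ℤ - y) ≡ y
  -[0-y]≡y = solve-∀
  [∣-[x-r]]≡0 : [ q zero ∣ 0ℤ - (x - r zero) ] ≡ 0ℤ
  [∣-[x-r]]≡0 with + q zero ∣? 0ℤ - (x - r zero)
  ... | no  _ = refl
  ... | yes q∣ = ⊥-elim (x∉ zero (∣⇒∣ᵤ (subst (+ q zero ∣_) (-[0-y]≡y (x - r zero)) (∣m⇒∣-m q∣))))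

_∈AP?_ : ∀ x a → Dec (x ∈AP a)
x ∈AP? (r mod q) = q ℕ.∣? ∣ x - r ∣

Covered : ∀ {m} → (Fin m → ℤ) → (Fin m → ℕ) → ℤ → Set
Covered r q x = ∃[ i ] x ∈AP (r i mod q i)

covered-interval⇒covered : ∀ {m} (r : Fin m → ℤ) q a →
  (∀ t → t < 2 ^ m → Covered r q (a + + t)) → ∀ x → Covered r q x
covered-interval⇒covered {m} r q a intervalCovered x with any? (λ i → x ∈AP? (r i mod q i))
... | yes x-covered = x-covered
... | no  x-uncovered = ⊥-elim (1ℤ≢0ℤ (begin
  1ℤ
    ≡⟨ sym (uncoveredIndicator-uncovered r q x (λ i x∈ → x-uncovered (i , x∈))) ⟩
  shiftSum (uncoveredIndicator r q) x (replicate m 0ℤ)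
    ≡⟨ shiftSum-vanishes (uncoveredIndicator r q) a vanishesOnInterval x (replicate m 0ℤ) ⟩
  0ℤ ∎))
  where
  open ≡-Reasoning
  1ℤ≢0ℤ : ¬ 1ℤ ≡ 0ℤ
  1ℤ≢0ℤ ()
  vanishesOnInterval : ∀ t → t < 2 ^ m → ∀ γ → shiftSum (uncoveredIndicator r q) (a + + t) γ ≡ 0ℤ
  vanishesOnInterval t t<2^m = let i , a+t∈ = intervalCovered t t<2^m in
    uncoveredIndicator-covered r q (a + + t) i a+t∈

below : ∀ {k} → Fin k → Subset k
below ℓ = tabulate (λ j → toℕ j <ᵇ toℕ ℓ)

<⇒∈below : ∀ {k} {ℓ j : Fin k} → toℕ j < toℕ ℓ → j ∈ below ℓ
<⇒∈below {ℓ = ℓ} {j} j<ℓ =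
  lookup⇒[]= j (below ℓ) (trans (lookup∘tabulate _ j) (Equivalence.to T-≡ (ℕ.<⇒<ᵇ j<ℓ)))

∈below⇒< : ∀ {k} {ℓ j : Fin k} → j ∈ below ℓ → toℕ j < toℕ ℓ
∈below⇒< {ℓ = ℓ} {j} j∈ =
  ℕ.<ᵇ⇒< _ _ (Equivalence.from T-≡ (trans (sym (lookup∘tabulate _ j)) ([]=⇒lookup j∈)))

InCℓ : ∀ {k} → (Fin k → ℤ) → (Fin k → ℕ) → Fin k → ℤ → Set
InCℓ r q ℓ n = ∃[ j ] (toℕ ℓ ≤ toℕ j × ∃[ h ] n ∈AP ((r j - + toℕ {2 ^ toℕ ℓ} h) mod q j))

inCℓ? : ∀ {k} (r : Fin k → ℤ) q ℓ n → Dec (InCℓ r q ℓ n)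
inCℓ? r q ℓ n = any? λ j → (toℕ ℓ ℕ.≤? toℕ j) ×-dec any? λ h → n ∈AP? ((r j - + toℕ h) mod q j)

∉Cℓ⇒below-covers-interval : ∀ {k} (r : Fin k → ℤ) q ℓ n → IsCovering r q → ¬ InCℓ r q ℓ n →
  ∀ t → t < 2 ^ toℕ ℓ → Covered (r ∘ inject {i = ℓ}) (q ∘ inject) (n + + t)
∉Cℓ⇒below-covers-interval r q ℓ n covering n∉Cℓ t t<2^ℓ with covering (n + + t)
... | _ , (j , refl) , n+t∈ with toℕ ℓ ℕ.≤? toℕ j
...   | yes ℓ≤j = ⊥-elim (n∉Cℓ (j , ℓ≤j , fromℕ< t<2^ℓ , n∈r-t))
  where
  n+t-r≡n-[r-t] : ∀ n t r → n + t - r ≡ n - (r - t)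
  n+t-r≡n-[r-t] = solve-∀
  n∈r-t : n ∈AP ((r j - + toℕ (fromℕ< t<2^ℓ)) mod q j)
  n∈r-t rewrite toℕ-fromℕ< t<2^ℓ = subst (+ q j ∣ᵤ_) (n+t-r≡n-[r-t] n (+ t) (r j)) n+t∈
...   | no  ℓ≰j = fromℕ< j<ℓ , subst (λ i → (n + + t) ∈AP (r i mod q i)) (sym inject-fromℕ<) n+t∈
  where
  j<ℓ = ℕ.≰⇒> ℓ≰j
  inject-fromℕ< : inject (fromℕ< j<ℓ) ≡ j
  inject-fromℕ< = toℕ-injective (trans (toℕ-inject (fromℕ< j<ℓ)) (toℕ-fromℕ< j<ℓ))

below-covers : ∀ {k} (r : Fin k → ℤ) q ℓ → (∀ x → Covered (r ∘ inject {i = ℓ}) (q ∘ inject) x) →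
  CoversℤSet (Sub r q (below ℓ))
below-covers r q ℓ covered x with covered x
... | i , x∈ = r (inject i) mod q (inject i)
             , (inject i , <⇒∈below (subst (_< toℕ ℓ) (sym (toℕ-inject i)) (toℕ<n i)) , refl)
             , x∈

claim1 : (k : ℕ) (r : Fin k → ℤ) (q : Fin k → ℕ)
    → (∀ i → 1 ≤ q i)
    → (∀ i j → toℕ i < toℕ j → q i < q j)
    → IsMinimalCovering r q
    → ∀ (ℓ : Fin k) → CoversℤSet (Cℓ r q ℓ)
claim1 k r q _ _ (covering , minimal) ℓ n with inCℓ? r q ℓ n
... | yes (j , ℓ≤j , h , n∈) = (r j - + toℕ h) mod q j , (j , toℕ h , ℓ≤j , toℕ<n h , refl) , n∈
... | no  n∉Cℓ = ⊥-elim (ℕ.<-irrefl refl (∈below⇒< (minimal (below ℓ) belowCovers ℓ)))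
  where
  belowCovers : CoversℤSet (Sub r q (below ℓ))
  belowCovers = below-covers r q ℓ (covered-interval⇒covered (r ∘ inject) (q ∘ inject) n
    (∉Cℓ⇒below-covers-interval r q ℓ n covering n∉Cℓ))
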